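{- Let $(a_k)_{k\ge0}$ and $(b_k)_{k\ge-1}$ be the polynomial sequences in $u,t$ defined by $a_k=(u+2t+3)a_{k-1}-(t+1)^2a_{k-2}$ and $b_k=(u+2t+3)b_{k-1}-(t+1)^2b_{k-2}$ with $b_{ -1}=0$, $a_0=b_0=1$, $a_1=u+3t+4$. Then for all $k\ge1$, $$a_k=\sum_{M}(t+1)^{|M|}(u+1)^{k-|M|},$$ the sum over all matchings $M$ of the cycle graph $C_{2k+1}$ on $2k+1$ vertices, and for all $k\ge0$, $$b_k=\sum_{M}(t+1)^{|M|}(u+1)^{k-|M|},$$ the sum over all matchings $M$ of the path graph $L_{2k+1}$ on $2k+1$ vertices.
   Context: A matching of a graph is a set of pairwise non-adjacent (vertex-disjoint) edges; $|M|$ is the number of edges in $M$. $L_{2k+1}$ denotes the path ("line") graph with $2k+1$ vertices and $2k$ edges. -}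

module Defs where

open import Level using (Level)
open import Data.Nat as ℕ using (ℕ; zero; suc; _∸_)
open import Data.Nat.DivMod using (_%_; m%n<n)
open import Data.Fin using (Fin; zero; suc; toℕ; fromℕ<; inject₁; _≟_)
open import Data.Fin.Properties using (all?)
open import Data.Fin.Subset using (Subset; _∈_; ∣_∣; inside; outside)
open import Data.Fin.Subset.Properties using (_∈?_)
open import Data.Product using (_×_; _,_)
open import Data.List using (List; []; _∷_; _++_; map; filter; foldr)
open import Data.Vec using (Vec; []; _∷_)
open import Relation.Nullary using (¬_; Dec; _→-dec_; _×-dec_; ¬?)
open import Relation.Binary.PropositionalEquality using (_≡_; _≢_)
open import Algebra.Bundles using (CommutativeRing; Semiring)

Edges : ℕ → ℕ → Set
Edges n m = Fin m → Fin n × Fin n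

Disjoint : ∀ {n} → Fin n × Fin n → Fin n × Fin n → Set
Disjoint (x , y) (z , w) = (x ≢ z × x ≢ w) × (y ≢ z × y ≢ w)

Disjoint? : ∀ {n} (e f : Fin n × Fin n) → Dec (Disjoint e f)
Disjoint? (x , y) (z , w) =
  (¬? (x ≟ z) ×-dec ¬? (x ≟ w)) ×-dec (¬? (y ≟ z) ×-dec ¬? (y ≟ w))

IsMatching : ∀ {n m} → Edges n m → Subset m → Set
IsMatching E S = ∀ i j → i ∈ S → j ∈ S → i ≢ j → Disjoint (E i) (E j)

IsMatching? : ∀ {n m} (E : Edges n m) (S : Subset m) → Dec (IsMatching E S)
IsMatching? E S = all? λ i → all? λ j →
  (i ∈? S) →-dec ((j ∈? S) →-dec (¬? (i ≟ j) →-dec Disjoint? (E i) (E j)))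

allSubsets : ∀ m → List (Subset m)
allSubsets zero = [] ∷ []
allSubsets (suc m) = map (outside ∷_) (allSubsets m) ++ map (inside ∷_) (allSubsets m)

matchings : ∀ {n m} → Edges n m → List (Subset m)
matchings E = filter (IsMatching? E) (allSubsets _)

cycleEdges : ∀ p → Edges (suc p) (suc p)
cycleEdges p i = i , fromℕ< (m%n<n (suc (toℕ i)) (suc p))

pathEdges : ∀ p → Edges (suc p) p
pathEdges p i = inject₁ i , suc i

module RingDefs {c ℓ : Level} (R : CommutativeRing c ℓ) where
  open CommutativeRing R

  open import Algebra.Definitions.RawSemiring (Semiring.rawSemiring semiring) using (_^_)

  sumR : List Carrier → Carrier
  sumR = foldr _+_ 0#

  two three four : Carrier
  two = 1# + 1#
  three = two + 1#
  four = three + 1#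

  matchingSum : ∀ {n m} → Carrier → Carrier → ℕ → Edges n m → Carrier
  matchingSum u t k E =
    sumR (map (λ M → ((t + 1#) ^ ∣ M ∣) * ((u + 1#) ^ (k ∸ ∣ M ∣))) (matchings E))

  coef : Carrier → Carrier → Carrier
  coef u t = (u + two * t) + three

  aSeq : Carrier → Carrier → ℕ → Carrier
  aSeq u t zero = 1#
  aSeq u t (suc zero) = (u + three * t) + four
  aSeq u t (suc (suc k)) =
    coef u t * aSeq u t (suc k) - ((t + 1#) ^ 2) * aSeq u t k

  -- bShift n = b_{n-1}, so bShift 0 = b_{-1} = 0 and bShift 1 = b_0 = 1
  bShift : Carrier → Carrier → ℕ → Carrier
  bShift u t zero = 0#
  bShift u t (suc zero) = 1#
  bShift u t (suc (suc k)) =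
    coef u t * bShift u t (suc k) - ((t + 1#) ^ 2) * bShift u t k

  bSeq : Carrier → Carrier → ℕ → Carrier
  bSeq u t k = bShift u t (suc k)

-- A matching of the path with n edges is a set of edge indices without two consecutive ones; a
-- matching of the cycle is such a set for the path left after deleting edge 0 (rotated by one
-- vertex), which in addition avoids both neighbours of edge 0 when edge 0 is used. Summing the
-- weights (t+1)^|M| (u+1)^(k-|M|) by the first edge gives Fibonacci-type recursions: those of the
-- paths with 2k and 2k+1 edges couple into the recurrence of b_k, and the cycle splits as
-- a_k = b_k + (t+1) b_{k-1}.
module Submission where

open import Algebra.Bundles using (CommutativeRing)
open import Defs

module Matchings where

  open import Data.Bool using (Bool; true; false; not; _∧_; T)
  open import Data.Bool.Properties using (T-∧; T-not-≡; ∧-comm)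
  open import Data.Empty using (⊥-elim)
  open import Data.Fin using (Fin; zero; suc; toℕ; fromℕ; inject₁)
  open import Data.Fin.Properties using (toℕ-injective; toℕ-fromℕ<; toℕ-fromℕ; toℕ-inject₁; toℕ<n; suc-injective)
  open import Data.Fin.Relation.Unary.Top using (view; ‵fromℕ; ‵inject₁)
  open import Data.Fin.Subset using (Subset; _∈_; _∉_; inside; outside)
  open import Data.Nat using (zero; suc; s≤s; _%_)
  open import Data.Nat.DivMod using (m<n⇒m%n≡m; n%n≡0)
  open import Data.Product as Prod using (_×_; _,_; proj₁; proj₂)
  open import Data.Unit using (⊤; tt)
  open import Data.Vec using ([]; _∷_; here; there)
  open import Function using (_∘_; _⇔_; mk⇔; Equivalence)
  open import Function.Definitions using (Injective)
  open import Relation.Binary.PropositionalEquality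
    using (_≡_; refl; sym; trans; cong; subst; subst₂; ≢-sym; module ≡-Reasoning)

  open Equivalence

  Disjoint-sym : ∀ {n} {e f : Fin n × Fin n} → Disjoint e f → Disjoint f e
  Disjoint-sym ((x≢z , x≢w) , (y≢z , y≢w)) = (≢-sym x≢z , ≢-sym y≢z) , (≢-sym x≢w , ≢-sym y≢w)

  Disjoint-map⇔ : ∀ {n n′} (h : Fin n → Fin n′) → Injective _≡_ _≡_ h →
                  ∀ {e f} → Disjoint (Prod.map h h e) (Prod.map h h f) ⇔ Disjoint e f
  Disjoint-map⇔ h h-inj = mk⇔
    (λ ((a , b) , (c , d)) → (a ∘ cong h , b ∘ cong h) , (c ∘ cong h , d ∘ cong h))
    (λ ((a , b) , (c , d)) → (a ∘ h-inj , b ∘ h-inj) , (c ∘ h-inj , d ∘ h-inj))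

  IsMatching-relabel : ∀ {n n′ m} {E : Edges n m} {E′ : Edges n′ m}
                       (h : Fin n → Fin n′) → Injective _≡_ _≡_ h →
                       (∀ i → E′ i ≡ Prod.map h h (E i)) →
                       ∀ S → IsMatching E′ S ⇔ IsMatching E S
  IsMatching-relabel h h-inj E′≡ S = mk⇔
    (λ M i j i∈S j∈S i≢j → to disj (subst₂ Disjoint (E′≡ i) (E′≡ j) (M i j i∈S j∈S i≢j)))
    (λ M i j i∈S j∈S i≢j → subst₂ Disjoint (sym (E′≡ i)) (sym (E′≡ j)) (from disj (M i j i∈S j∈S i≢j)))
    where disj = Disjoint-map⇔ h h-inj

  IsMatching-∷⇔ : ∀ {n m} (E : Edges n (suc m)) x S →
    IsMatching E (x ∷ S) ⇔
    (IsMatching (E ∘ suc) S × (x ≡ inside → ∀ i → i ∈ S → Disjoint (E zero) (E (suc i))))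
  IsMatching-∷⇔ E x S = mk⇔
    (λ M → (λ i j i∈S j∈S i≢j → M (suc i) (suc j) (there i∈S) (there j∈S) (i≢j ∘ suc-injective))
         , λ { refl i i∈S → M zero (suc i) here (there i∈S) λ () })
    (λ (M , head) → build M head)
    where
    build : IsMatching (E ∘ suc) S → (x ≡ inside → ∀ i → i ∈ S → Disjoint (E zero) (E (suc i))) →
            IsMatching E (x ∷ S)
    build M head zero    zero    _          _          0≢0 = ⊥-elim (0≢0 refl)
    build M head zero    (suc j) here       (there j∈S) _  = head refl j j∈S
    build M head (suc i) zero    (there i∈S) here       _  = Disjoint-sym (head refl i i∈S)
    build M head (suc i) (suc j) (there i∈S) (there j∈S) i≢j = M i j i∈S j∈S (i≢j ∘ cong suc)

  -- noAdjacent p e S: the bit string p ∷ S ∷ʳ e has no two consecutive insides.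
  noAdjacent : Bool → Bool → ∀ {m} → Subset m → Bool
  noAdjacent p e []      = not (p ∧ e)
  noAdjacent p e (x ∷ S) = not (p ∧ x) ∧ noAdjacent x e S

  HeadOutside : ∀ {m} → Subset m → Set
  HeadOutside []      = ⊤
  HeadOutside (x ∷ _) = x ≡ outside

  LastOutside : Bool → ∀ {m} → Subset m → Set
  LastOutside p []      = p ≡ outside
  LastOutside _ (x ∷ S) = LastOutside x S

  T-nand⇔ : ∀ {p x} → T (not (p ∧ x)) ⇔ (p ≡ true → x ≡ false)
  T-nand⇔ {false} = mk⇔ (λ _ ()) (λ _ → tt)
  T-nand⇔ {true}  = mk⇔ (λ ok _ → to T-not-≡ ok) (λ p→x → from T-not-≡ (p→x refl))

  pathHead⇔HeadOutside : ∀ {m} (S : Subset m) →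
    (∀ i → i ∈ S → Disjoint (pathEdges (suc m) zero) (pathEdges (suc m) (suc i))) ⇔ HeadOutside S
  pathHead⇔HeadOutside S = mk⇔ (to′ S) (from′ S)
    where
    to′ : ∀ {m} (S : Subset m) →
          (∀ i → i ∈ S → Disjoint (pathEdges (suc m) zero) (pathEdges (suc m) (suc i))) → HeadOutside S
    to′ []            _     = tt
    to′ (outside ∷ S) _     = refl
    to′ (inside ∷ S)  disj = ⊥-elim (proj₁ (proj₂ (disj zero here)) refl)

    from′ : ∀ {m} (S : Subset m) → HeadOutside S →
            ∀ i → i ∈ S → Disjoint (pathEdges (suc m) zero) (pathEdges (suc m) (suc i))
    from′ (.inside ∷ S) () zero here
    from′ (x ∷ S)       _  (suc i) (there _) = ((λ ()) , (λ ())) , ((λ ()) , (λ ()))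

  pathMatching-∷⇔ : ∀ {m} x (S : Subset m) →
    IsMatching (pathEdges (suc m)) (x ∷ S) ⇔ (IsMatching (pathEdges m) S × (x ≡ inside → HeadOutside S))
  pathMatching-∷⇔ x S = mk⇔
    (λ M → let (M′ , head) = to cons M in to shift M′ , to (pathHead⇔HeadOutside S) ∘ head)
    (λ (M′ , head) → from cons (from shift M′ , from (pathHead⇔HeadOutside S) ∘ head))
    where
    cons  = IsMatching-∷⇔ (pathEdges _) x S
    shift = IsMatching-relabel suc suc-injective (λ _ → refl) S

  noAdjacent⇔pathMatching : ∀ {m} p e (S : Subset m) →
    T (noAdjacent p e S) ⇔
    (IsMatching (pathEdges m) S × (p ≡ inside → HeadOutside S) × (e ≡ inside → LastOutside p S))
  noAdjacent⇔pathMatching p e [] = mk⇔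
    (λ ok → (λ ()) , (λ _ → tt) , to T-nand⇔ (subst (T ∘ not) (∧-comm p e) ok))
    (λ (_ , _ , e→p) → subst (T ∘ not) (∧-comm e p) (from T-nand⇔ e→p))
  noAdjacent⇔pathMatching p e (x ∷ S) = mk⇔
    (λ ok → let (p→x , rest) = to T-∧ ok
                (M , x→head , e→last) = to tail rest
            in from (pathMatching-∷⇔ x S) (M , x→head) , to T-nand⇔ p→x , e→last)
    (λ (M , p→x , e→last) → let (M′ , x→head) = to (pathMatching-∷⇔ x S) M
                            in from T-∧ (from T-nand⇔ p→x , from tail (M′ , x→head , e→last)))
    where tail = noAdjacent⇔pathMatching x e S

  rotate : ∀ {p} → Fin (suc p) → Fin (suc p)
  rotate {p} i = proj₂ (cycleEdges p i)

  rotate-inject₁ : ∀ {p} (i : Fin p) → rotate (inject₁ i) ≡ suc i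
  rotate-inject₁ {p} i = toℕ-injective (begin
    toℕ (rotate (inject₁ i))       ≡⟨ toℕ-fromℕ< _ ⟩
    suc (toℕ (inject₁ i)) % suc p  ≡⟨ cong (λ n → suc n % suc p) (toℕ-inject₁ i) ⟩
    suc (toℕ i) % suc p            ≡⟨ m<n⇒m%n≡m (s≤s (toℕ<n i)) ⟩
    suc (toℕ i)                    ∎)
    where open ≡-Reasoning

  rotate-fromℕ : ∀ p → rotate (fromℕ p) ≡ zero
  rotate-fromℕ p = toℕ-injective (begin
    toℕ (rotate (fromℕ p))       ≡⟨ toℕ-fromℕ< _ ⟩
    suc (toℕ (fromℕ p)) % suc p  ≡⟨ cong (λ n → suc n % suc p) (toℕ-fromℕ p) ⟩
    suc p % suc p                ≡⟨ n%n≡0 (suc p) ⟩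
    0                            ∎)
    where open ≡-Reasoning

  rotate-injective : ∀ {p} → Injective _≡_ _≡_ (rotate {p})
  rotate-injective {p} {a} {b} eq with view a | view b
  ... | ‵fromℕ     | ‵fromℕ     = refl
  ... | ‵fromℕ     | ‵inject₁ j with () ← trans (sym (rotate-fromℕ p)) (trans eq (rotate-inject₁ j))
  ... | ‵inject₁ i | ‵fromℕ     with () ← trans (sym (rotate-fromℕ p)) (trans (sym eq) (rotate-inject₁ i))
  ... | ‵inject₁ i | ‵inject₁ j =
    cong inject₁ (suc-injective (trans (sym (rotate-inject₁ i)) (trans eq (rotate-inject₁ j))))

  cycleEdges-suc : ∀ {p} (i : Fin (suc p)) →
                   cycleEdges (suc p) (suc i) ≡ Prod.map rotate rotate (pathEdges (suc p) i)
  cycleEdges-suc i = cong (_, rotate (suc i)) (sym (rotate-inject₁ i))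

  cycleHead⇔ : ∀ {p} (S : Subset (suc p)) →
    (∀ i → i ∈ S → Disjoint (cycleEdges (suc p) zero) (cycleEdges (suc p) (suc i))) ⇔
    (zero ∉ S × fromℕ p ∉ S)
  cycleHead⇔ {p} S = mk⇔
    (λ disj → (λ 0∈S → proj₁ (proj₂ (disj zero 0∈S)) refl)
            , (λ last∈S → proj₂ (proj₁ (disj (fromℕ p) last∈S)) (sym (rotate-fromℕ (suc p)))))
    (λ (0∉S , last∉S) i i∈S → disjoint 0∉S last∉S i i∈S)
    where
    disjoint : zero ∉ S → fromℕ p ∉ S →
               ∀ i → i ∈ S → Disjoint (cycleEdges (suc p) zero) (cycleEdges (suc p) (suc i))
    disjoint 0∉S last∉S i i∈S with view i
    ... | ‵fromℕ           = ⊥-elim (last∉S i∈S)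
    ... | ‵inject₁ zero    = ⊥-elim (0∉S i∈S)
    ... | ‵inject₁ (suc j) rewrite rotate-inject₁ (suc (suc j)) = ((λ ()) , (λ ())) , ((λ ()) , (λ ()))

  HeadOutside⇔zero∉ : ∀ {p} (S : Subset (suc p)) → HeadOutside S ⇔ zero ∉ S
  HeadOutside⇔zero∉ (x ∷ S) = mk⇔ (λ { refl () }) (from′ x)
    where
    from′ : ∀ x → zero ∉ x ∷ S → x ≡ outside
    from′ outside _   = refl
    from′ inside  0∉S = ⊥-elim (0∉S here)

  LastOutside⇔fromℕ∉ : ∀ {p} b (S : Subset (suc p)) → LastOutside b S ⇔ fromℕ p ∉ S
  LastOutside⇔fromℕ∉ b S = mk⇔ (to′ b S) (from′ b S)
    where
    to′ : ∀ {p} b (S : Subset (suc p)) → LastOutside b S → fromℕ p ∉ S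
    to′ b (.inside ∷ [])    ()   here
    to′ b (x ∷ y ∷ S)       last (there i∈S) = to′ x (y ∷ S) last i∈S

    from′ : ∀ {p} b (S : Subset (suc p)) → fromℕ p ∉ S → LastOutside b S
    from′ b (outside ∷ []) _       = refl
    from′ b (inside ∷ [])  last∉S  = ⊥-elim (last∉S here)
    from′ b (x ∷ y ∷ S)    last∉S  = from′ x (y ∷ S) (last∉S ∘ there)

  noAdjacentCyclic : ∀ {m} → Subset (suc m) → Bool
  noAdjacentCyclic (x ∷ S) = noAdjacent x x S

  pathMatching⇔noAdjacent : ∀ {m} (S : Subset m) →
    IsMatching (pathEdges m) S ⇔ T (noAdjacent false false S)
  pathMatching⇔noAdjacent S = mk⇔ (λ M → from path (M , (λ ()) , (λ ()))) (proj₁ ∘ to path)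
    where path = noAdjacent⇔pathMatching false false S

  cycleMatching⇔noAdjacentCyclic : ∀ {p} (S : Subset (suc (suc p))) →
    IsMatching (cycleEdges (suc p)) S ⇔ T (noAdjacentCyclic S)
  cycleMatching⇔noAdjacentCyclic (x ∷ S) = mk⇔
    (λ M → let (M′ , head) = to cons M
               avoid = to (cycleHead⇔ S) ∘ head
           in from path (to tail M′ , from (HeadOutside⇔zero∉ S) ∘ proj₁ ∘ avoid
                                    , from (LastOutside⇔fromℕ∉ x S) ∘ proj₂ ∘ avoid))
    (λ ok → let (M , x→head , x→last) = to path ok
            in from cons (from tail M , λ x≡in → from (cycleHead⇔ S)
                            ( to (HeadOutside⇔zero∉ S) (x→head x≡in)
                            , to (LastOutside⇔fromℕ∉ x S) (x→last x≡in))))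
    where
    cons = IsMatching-∷⇔ (cycleEdges _) x S
    tail = IsMatching-relabel rotate rotate-injective cycleEdges-suc S
    path = noAdjacent⇔pathMatching x x S

module MatchingSums {r ℓ} (R : CommutativeRing r ℓ) where

  open import Algebra.Bundles using (Semiring)
  import Algebra.Definitions.RawSemiring as RawSemiringDefinitions
  import Algebra.Properties.CommutativeSemigroup as CommutativeSemigroupProperties
  import Algebra.Properties.Ring as RingProperties
  import Algebra.Solver.Ring.NaturalCoefficients.Default as NaturalSolver
  open import Data.Bool using (Bool; true; false; T)
  open import Data.Fin.Subset using (Subset; ∣_∣; inside; outside)
  open import Data.List using (List; []; _∷_; _++_; map; filter)
  open import Data.List.Properties using (filter-≐; filter-++; map-++)
  open import Data.Nat as ℕ using (ℕ; zero; suc; _∸_; _≤_; z≤n; s≤s)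
  open import Data.Nat.Properties using (+-suc; +-∸-assoc; m≤n⇒m≤1+n)
  open import Data.Product using (_×_; _,_; proj₁)
  open import Data.Vec using (_∷_)
  open import Function using (_∘_; _⇔_; Equivalence)
  open import Relation.Nullary.Decidable using (T?)
  open import Relation.Binary.PropositionalEquality as ≡ using (_≡_)
  import Relation.Binary.Reasoning.Setoid as SetoidReasoning
  open Matchings

  double : ℕ → ℕ
  double zero    = zero
  double (suc k) = suc (suc (double k))

  double≡+ : ∀ k → double k ≡ k ℕ.+ k
  double≡+ zero    = ≡.refl
  double≡+ (suc k) = ≡.cong suc (≡.trans (≡.cong suc (double≡+ k)) (≡.sym (+-suc k k)))

  half-≤ : ∀ j k → j ℕ.+ j ≤ suc (double k) → j ≤ k
  half-≤ zero    k       _  = z≤n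
  half-≤ (suc j) zero    (s≤s j+1+j≤0) rewrite +-suc j j with () ← j+1+j≤0
  half-≤ (suc j) (suc k) (s≤s j+1+j≤) rewrite +-suc j j = s≤s (half-≤ j k (ℕ.s≤s⁻¹ j+1+j≤))

  open CommutativeRing R hiding (zero)
  open RingDefs R
  open RawSemiringDefinitions (Semiring.rawSemiring semiring) using (_^_)
  open RingProperties ring using (+-cancelʳ; //-rightDividesˡ; -0#≈0#)
  open CommutativeSemigroupProperties *-commutativeSemigroup using (x∙yz≈y∙xz)
  open NaturalSolver commutativeSemiring using (solve; _:+_; _:*_; _:=_; con)
  open SetoidReasoning setoid

  -- f (k + 2) = c f (k + 1) - d f k, stated additively so that the semiring solver applies.
  LinearRecurrence : Carrier → Carrier → (ℕ → Carrier) → Set ℓ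
  LinearRecurrence c d f = ∀ k → f (suc (suc k)) + d * f k ≈ c * f (suc k)

  subtractive⇒linearRecurrence : ∀ {c d} (f : ℕ → Carrier) →
    (∀ k → f (suc (suc k)) ≈ c * f (suc k) - d * f k) → LinearRecurrence c d f
  subtractive⇒linearRecurrence {c} {d} f f≈ k = begin
    f (suc (suc k)) + d * f k                  ≈⟨ +-congʳ (f≈ k) ⟩
    (c * f (suc k) - d * f k) + d * f k        ≈⟨ //-rightDividesˡ (d * f k) (c * f (suc k)) ⟩
    c * f (suc k)                              ∎

  linearRecurrence-unique : ∀ {c d f g} → LinearRecurrence c d f → LinearRecurrence c d g →
    f 0 ≈ g 0 → f 1 ≈ g 1 → ∀ k → f k ≈ g k
  linearRecurrence-unique {c} {d} {f} {g} rec-f rec-g f₀≈g₀ f₁≈g₁ = proj₁ ∘ agree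
    where
    agree : ∀ k → f k ≈ g k × f (suc k) ≈ g (suc k)
    agree zero    = f₀≈g₀ , f₁≈g₁
    agree (suc k) with fₖ≈gₖ , fₖ₊₁≈gₖ₊₁ ← agree k =
      fₖ₊₁≈gₖ₊₁ , +-cancelʳ (d * f k) _ _ (begin
        f (suc (suc k)) + d * f k  ≈⟨ rec-f k ⟩
        c * f (suc k)              ≈⟨ *-congˡ fₖ₊₁≈gₖ₊₁ ⟩
        c * g (suc k)              ≈⟨ rec-g k ⟨
        g (suc (suc k)) + d * g k  ≈⟨ +-congˡ (*-congˡ fₖ≈gₖ) ⟨
        g (suc (suc k)) + d * f k  ∎)

  linearRecurrence-shift : ∀ {c d f} → LinearRecurrence c d f →
    ∀ e → LinearRecurrence c d (λ k → f (suc k) + e * f k)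
  linearRecurrence-shift {c} {d} {f} rec e k = begin
    (f₃ + e * f₂) + d * (f₁ + e * f₀)  ≈⟨ solve 6 (λ x y z w e d →
                                             (x :+ e :* y) :+ d :* (z :+ e :* w) := (x :+ d :* z) :+ e :* (y :+ d :* w))
                                           refl f₃ f₂ f₁ f₀ e d ⟩
    (f₃ + d * f₁) + e * (f₂ + d * f₀)  ≈⟨ +-cong (rec (suc k)) (*-congˡ (rec k)) ⟩
    c * f₂ + e * (c * f₁)              ≈⟨ +-congˡ (x∙yz≈y∙xz e c f₁) ⟩
    c * f₂ + c * (e * f₁)              ≈⟨ distribˡ c f₂ (e * f₁) ⟨
    c * (f₂ + e * f₁)                  ∎
    where
    f₀ f₁ f₂ f₃ : Carrier
    f₀ = f k
    f₁ = f (suc k)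
    f₂ = f (suc (suc k))
    f₃ = f (suc (suc (suc k)))

  sumR-++ : ∀ xs ys → sumR (xs ++ ys) ≈ sumR xs + sumR ys
  sumR-++ []       ys = sym (+-identityˡ (sumR ys))
  sumR-++ (x ∷ xs) ys = trans (+-congˡ (sumR-++ xs ys)) (sym (+-assoc x (sumR xs) (sumR ys)))

  filteredSum : ∀ {m} → (Subset m → Bool) → (ℕ → Carrier) → List (Subset m) → Carrier
  filteredSum b φ L = sumR (map (φ ∘ ∣_∣) (filter (T? ∘ b) L))

  filteredSum-++ : ∀ {m} (b : Subset m → Bool) φ xs ys →
    filteredSum b φ (xs ++ ys) ≈ filteredSum b φ xs + filteredSum b φ ys
  filteredSum-++ b φ xs ys = begin
    sumR (map (φ ∘ ∣_∣) (filter (T? ∘ b) (xs ++ ys)))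
      ≡⟨ ≡.cong (sumR ∘ map (φ ∘ ∣_∣)) (filter-++ (T? ∘ b) xs ys) ⟩
    sumR (map (φ ∘ ∣_∣) (filter (T? ∘ b) xs ++ filter (T? ∘ b) ys))
      ≡⟨ ≡.cong sumR (map-++ (φ ∘ ∣_∣) (filter (T? ∘ b) xs) (filter (T? ∘ b) ys)) ⟩
    sumR (map (φ ∘ ∣_∣) (filter (T? ∘ b) xs) ++ map (φ ∘ ∣_∣) (filter (T? ∘ b) ys))
      ≈⟨ sumR-++ (map (φ ∘ ∣_∣) (filter (T? ∘ b) xs)) (map (φ ∘ ∣_∣) (filter (T? ∘ b) ys)) ⟩
    filteredSum b φ xs + filteredSum b φ ys ∎

  filteredSum-outside : ∀ {m} (b : Subset (suc m) → Bool) φ L →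
    filteredSum b φ (map (outside ∷_) L) ≡ filteredSum (b ∘ (outside ∷_)) φ L
  filteredSum-outside b φ []      = ≡.refl
  filteredSum-outside b φ (S ∷ L) with b (outside ∷ S)
  ... | true  = ≡.cong (φ ∣ S ∣ +_) (filteredSum-outside b φ L)
  ... | false = filteredSum-outside b φ L

  filteredSum-inside : ∀ {m} (b : Subset (suc m) → Bool) φ L →
    filteredSum b φ (map (inside ∷_) L) ≡ filteredSum (b ∘ (inside ∷_)) (φ ∘ suc) L
  filteredSum-inside b φ []      = ≡.refl
  filteredSum-inside b φ (S ∷ L) with b (inside ∷ S)
  ... | true  = ≡.cong (φ (suc ∣ S ∣) +_) (filteredSum-inside b φ L)
  ... | false = filteredSum-inside b φ L

  filteredSum-allSubsets-suc : ∀ {m} (b : Subset (suc m) → Bool) φ →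
    filteredSum b φ (allSubsets (suc m)) ≈
    filteredSum (b ∘ (outside ∷_)) φ (allSubsets m) + filteredSum (b ∘ (inside ∷_)) (φ ∘ suc) (allSubsets m)
  filteredSum-allSubsets-suc {m} b φ =
    trans (filteredSum-++ b φ (map (outside ∷_) (allSubsets m)) (map (inside ∷_) (allSubsets m)))
          (reflexive (≡.cong₂ _+_ (filteredSum-outside b φ (allSubsets m)) (filteredSum-inside b φ (allSubsets m))))

  filteredSum-none : ∀ {m} φ (L : List (Subset m)) → filteredSum (λ _ → false) φ L ≡ 0#
  filteredSum-none φ []      = ≡.refl
  filteredSum-none φ (_ ∷ L) = filteredSum-none φ L

  -- The suc clauses come first so that sparseSum true e (suc m) reduces for a variable e.
  sparseSum : Bool → Bool → ℕ → (ℕ → Carrier) → Carrier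
  sparseSum false e     (suc m) φ = sparseSum false e m φ + sparseSum true e m (φ ∘ suc)
  sparseSum true  e     (suc m) φ = sparseSum false e m φ
  sparseSum false e     zero    φ = φ 0
  sparseSum true  false zero    φ = φ 0
  sparseSum true  true  zero    φ = 0#

  filteredSum-noAdjacent : ∀ p e m φ → filteredSum (noAdjacent p e) φ (allSubsets m) ≈ sparseSum p e m φ
  filteredSum-noAdjacent false e     zero    φ = +-identityʳ (φ 0)
  filteredSum-noAdjacent true  false zero    φ = +-identityʳ (φ 0)
  filteredSum-noAdjacent true  true  zero    φ = refl
  filteredSum-noAdjacent false e     (suc m) φ =
    trans (filteredSum-allSubsets-suc {m} (noAdjacent false e) φ)
          (+-cong (filteredSum-noAdjacent false e m φ) (filteredSum-noAdjacent true e m (φ ∘ suc)))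
  filteredSum-noAdjacent true  e     (suc m) φ = begin
    filteredSum (noAdjacent true e) φ (allSubsets (suc m))
      ≈⟨ filteredSum-allSubsets-suc {m} (noAdjacent true e) φ ⟩
    filteredSum (noAdjacent false e) φ (allSubsets m) + filteredSum (λ _ → false) (φ ∘ suc) (allSubsets m)
      ≈⟨ +-cong (filteredSum-noAdjacent false e m φ) (reflexive (filteredSum-none (φ ∘ suc) (allSubsets m))) ⟩
    sparseSum false e m φ + 0#
      ≈⟨ +-identityʳ _ ⟩
    sparseSum false e m φ ∎

  pathSum : ℕ → (ℕ → Carrier) → Carrier
  pathSum = sparseSum false false

  sparseSum-lastOutside : ∀ n φ → sparseSum false true (suc n) φ ≈ pathSum n φ
  sparseSum-lastOutside zero          φ = +-identityʳ (φ 0)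
  sparseSum-lastOutside (suc zero)    φ = +-congʳ (+-identityʳ (φ 0))
  sparseSum-lastOutside (suc (suc n)) φ =
    +-cong (sparseSum-lastOutside (suc n) φ) (sparseSum-lastOutside n (φ ∘ suc))

  -- Only weights φ j with 2j ≤ n + 1 occur: this makes the truncated k ∸ j in the weights harmless.
  pathSum-cong : ∀ n {φ ψ} → (∀ j → j ℕ.+ j ≤ suc n → φ j ≈ ψ j) → pathSum n φ ≈ pathSum n ψ
  pathSum-cong zero          φ≈ψ = φ≈ψ 0 z≤n
  pathSum-cong (suc zero)    φ≈ψ = +-cong (φ≈ψ 0 z≤n) (φ≈ψ 1 (s≤s (s≤s z≤n)))
  pathSum-cong (suc (suc n)) φ≈ψ =
    +-cong (pathSum-cong (suc n) (λ j bound → φ≈ψ j (m≤n⇒m≤1+n bound)))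
           (pathSum-cong n (λ j bound → φ≈ψ (suc j) (s≤s (shift j bound))))
    where
    shift : ∀ j → j ℕ.+ j ≤ suc n → j ℕ.+ suc j ≤ suc (suc n)
    shift j bound = ≡.subst (_≤ suc (suc n)) (≡.sym (+-suc j j)) (s≤s bound)

  pathSum-scale : ∀ n c φ → pathSum n (λ j → c * φ j) ≈ c * pathSum n φ
  pathSum-scale zero          c φ = refl
  pathSum-scale (suc zero)    c φ = sym (distribˡ c (φ 0) (φ 1))
  pathSum-scale (suc (suc n)) c φ =
    trans (+-cong (pathSum-scale (suc n) c φ) (pathSum-scale n c (φ ∘ suc))) (sym (distribˡ c _ _))

  module Weighted (u t : Carrier) where

    v w : Carrier
    v = u + 1#
    w = t + 1#

    weight : ℕ → ℕ → Carrier
    weight k j = (w ^ j) * (v ^ (k ∸ j))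

    weight-suc-suc : ∀ k j → weight (suc k) (suc j) ≈ w * weight k j
    weight-suc-suc k j = *-assoc w (w ^ j) (v ^ (k ∸ j))

    weight-suc : ∀ {k j} → j ≤ k → weight (suc k) j ≈ v * weight k j
    weight-suc {k} {j} j≤k = begin
      w ^ j * v ^ (suc k ∸ j)      ≡⟨ ≡.cong (λ n → w ^ j * v ^ n) (+-∸-assoc 1 j≤k) ⟩
      w ^ j * (v * v ^ (k ∸ j))    ≈⟨ x∙yz≈y∙xz (w ^ j) v (v ^ (k ∸ j)) ⟩
      v * (w ^ j * v ^ (k ∸ j))    ∎

    matchingSum-≐ : ∀ {n m} (E : Edges n m) (b : Subset m → Bool) → (∀ S → IsMatching E S ⇔ T (b S)) →
      ∀ k → matchingSum u t k E ≡ filteredSum b (weight k) (allSubsets m)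
    matchingSum-≐ E b E⇔b k = ≡.cong (sumR ∘ map (weight k ∘ ∣_∣))
      (filter-≐ (IsMatching? E) (T? ∘ b) ((λ {S} → to (E⇔b S)) , (λ {S} → from (E⇔b S))) (allSubsets _))
      where open Equivalence

    pathMatchingSum : ∀ n k → matchingSum u t k (pathEdges n) ≈ pathSum n (weight k)
    pathMatchingSum n k = begin
      matchingSum u t k (pathEdges n)
        ≡⟨ matchingSum-≐ (pathEdges n) (noAdjacent false false) pathMatching⇔noAdjacent k ⟩
      filteredSum (noAdjacent false false) (weight k) (allSubsets n)
        ≈⟨ filteredSum-noAdjacent false false n (weight k) ⟩
      pathSum n (weight k) ∎

    cycleMatchingSum : ∀ n k → matchingSum u t k (cycleEdges (suc (suc n))) ≈
                               pathSum (suc (suc n)) (weight k) + pathSum n (weight k ∘ suc)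
    cycleMatchingSum n k = begin
      matchingSum u t k (cycleEdges (suc (suc n)))
        ≡⟨ matchingSum-≐ (cycleEdges (suc (suc n))) noAdjacentCyclic cycleMatching⇔noAdjacentCyclic k ⟩
      filteredSum noAdjacentCyclic (weight k) (allSubsets (suc (suc (suc n))))
        ≈⟨ filteredSum-allSubsets-suc {suc (suc n)} noAdjacentCyclic (weight k) ⟩
      filteredSum (noAdjacent false false) (weight k) (allSubsets (suc (suc n))) +
      filteredSum (noAdjacent true true) (weight k ∘ suc) (allSubsets (suc (suc n)))
        ≈⟨ +-cong (filteredSum-noAdjacent false false (suc (suc n)) (weight k))
                  (filteredSum-noAdjacent true true (suc (suc n)) (weight k ∘ suc)) ⟩
      pathSum (suc (suc n)) (weight k) + sparseSum false true (suc n) (weight k ∘ suc)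
        ≈⟨ +-congˡ (sparseSum-lastOutside n (weight k ∘ suc)) ⟩
      pathSum (suc (suc n)) (weight k) + pathSum n (weight k ∘ suc) ∎

    pathSum-weight-suc : ∀ n k → pathSum n (weight (suc k) ∘ suc) ≈ w * pathSum n (weight k)
    pathSum-weight-suc n k = trans (pathSum-cong n (λ j _ → weight-suc-suc k j)) (pathSum-scale n w (weight k))

    evenPath oddPath : ℕ → Carrier
    evenPath k = pathSum (double k) (weight k)
    oddPath  k = pathSum (suc (double k)) (weight (suc k))

    evenPath-suc : ∀ k → evenPath (suc k) ≈ oddPath k + w * evenPath k
    evenPath-suc k = +-congˡ (pathSum-weight-suc (double k) k)

    oddPath-suc : ∀ k → oddPath (suc k) ≈ v * evenPath (suc k) + w * oddPath k
    oddPath-suc k = +-cong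
      (trans (pathSum-cong (double (suc k)) (λ j bound → weight-suc (half-≤ j (suc k) bound)))
             (pathSum-scale (double (suc k)) v (weight (suc k))))
      (pathSum-weight-suc (suc (double k)) (suc k))

    coef≈ : coef u t ≈ v + (w + w)
    coef≈ = solve 2 (λ u t → (u :+ con 2 :* t) :+ con 3 := (u :+ con 1) :+ ((t :+ con 1) :+ (t :+ con 1))) refl u t

    evenPath-recurrence : LinearRecurrence (coef u t) ((t + 1#) ^ 2) evenPath
    evenPath-recurrence k = begin
      evenPath (suc (suc k)) + w ^ 2 * a
        ≈⟨ +-congʳ (trans (evenPath-suc (suc k)) (+-congʳ (oddPath-suc k))) ⟩
      ((v * x + w * b) + w * x) + w ^ 2 * a
        ≈⟨ +-congʳ (+-cong (+-congʳ (*-congˡ x≈)) (*-congˡ x≈)) ⟩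
      ((v * (b + w * a) + w * b) + w * (b + w * a)) + w ^ 2 * a
        ≈⟨ solve 4 (λ v w a b → ((v :* (b :+ w :* a) :+ w :* b) :+ w :* (b :+ w :* a)) :+ (w :* (w :* con 1)) :* a
                                  := (v :+ (w :+ w)) :* (b :+ w :* a)) refl v w a b ⟩
      (v + (w + w)) * (b + w * a)
        ≈⟨ *-cong coef≈ x≈ ⟨
      coef u t * x ∎
      where
      a b x : Carrier
      a = evenPath k
      b = oddPath k
      x = evenPath (suc k)
      x≈ : x ≈ b + w * a
      x≈ = evenPath-suc k

    bShift-recurrence : LinearRecurrence (coef u t) ((t + 1#) ^ 2) (bShift u t)
    bShift-recurrence = subtractive⇒linearRecurrence (bShift u t) (λ _ → refl)

    aSeq-recurrence : LinearRecurrence (coef u t) ((t + 1#) ^ 2) (aSeq u t)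
    aSeq-recurrence = subtractive⇒linearRecurrence (aSeq u t) (λ _ → refl)

    bShift-two : bShift u t 2 ≈ coef u t
    bShift-two = begin
      coef u t * 1# - w ^ 2 * 0#  ≈⟨ +-cong (*-identityʳ (coef u t)) (-‿cong (zeroʳ (w ^ 2))) ⟩
      coef u t - 0#               ≈⟨ +-congˡ -0#≈0# ⟩
      coef u t + 0#               ≈⟨ +-identityʳ (coef u t) ⟩
      coef u t                    ∎

    evenPath-one : evenPath 1 ≈ coef u t
    evenPath-one = solve 2 (λ u t →
      (con 1 :* ((u :+ con 1) :* con 1) :+ ((t :+ con 1) :* con 1) :* con 1) :+ ((t :+ con 1) :* con 1) :* con 1
      := (u :+ con 2 :* t) :+ con 3) refl u t

    bSeq≈evenPath : ∀ k → bSeq u t k ≈ evenPath k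
    bSeq≈evenPath = linearRecurrence-unique (bShift-recurrence ∘ suc) evenPath-recurrence
      (sym (*-identityˡ 1#)) (trans bShift-two (sym evenPath-one))

    aSeq≈bShift : ∀ k → aSeq u t k ≈ bShift u t (suc k) + w * bShift u t k
    aSeq≈bShift = linearRecurrence-unique aSeq-recurrence (linearRecurrence-shift bShift-recurrence w)
      (solve 1 (λ t → con 1 := con 1 :+ (t :+ con 1) :* con 0) refl t)
      (trans (solve 2 (λ u t → (u :+ con 3 :* t) :+ con 4 := ((u :+ con 2 :* t) :+ con 3) :+ (t :+ con 1) :* con 1) refl u t)
             (+-congʳ (sym bShift-two)))

    bSeq≈pathMatchingSum : ∀ k → bSeq u t k ≈ matchingSum u t k (pathEdges (k ℕ.+ k))
    bSeq≈pathMatchingSum k = begin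
      bSeq u t k                                 ≈⟨ bSeq≈evenPath k ⟩
      pathSum (double k) (weight k)              ≈⟨ pathMatchingSum (double k) k ⟨
      matchingSum u t k (pathEdges (double k))   ≡⟨ ≡.cong (matchingSum u t k ∘ pathEdges) (double≡+ k) ⟩
      matchingSum u t k (pathEdges (k ℕ.+ k))    ∎

    aSeq≈cycleMatchingSum : ∀ k → aSeq u t (suc k) ≈ matchingSum u t (suc k) (cycleEdges (suc k ℕ.+ suc k))
    aSeq≈cycleMatchingSum k = begin
      aSeq u t (suc k)
        ≈⟨ aSeq≈bShift (suc k) ⟩
      bSeq u t (suc k) + w * bSeq u t k
        ≈⟨ +-cong (bSeq≈evenPath (suc k)) (*-congˡ (bSeq≈evenPath k)) ⟩
      evenPath (suc k) + w * evenPath k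
        ≈⟨ +-congˡ (pathSum-weight-suc (double k) k) ⟨
      pathSum (double (suc k)) (weight (suc k)) + pathSum (double k) (weight (suc k) ∘ suc)
        ≈⟨ cycleMatchingSum (double k) (suc k) ⟨
      matchingSum u t (suc k) (cycleEdges (double (suc k)))
        ≡⟨ ≡.cong (matchingSum u t (suc k) ∘ cycleEdges) (double≡+ (suc k)) ⟩
      matchingSum u t (suc k) (cycleEdges (suc k ℕ.+ suc k)) ∎

open import Level using (Level)
open import Data.Nat using (ℕ; suc; _+_)
open import Data.Product using (_×_; _,_)

mainTheorem10 : ∀ {c ℓ : Level} (R : CommutativeRing c ℓ) (u t : CommutativeRing.Carrier R) →
    let open CommutativeRing R using (_≈_)
        open RingDefs R
    in ((k : ℕ) → aSeq u t (suc k) ≈ matchingSum u t (suc k) (cycleEdges ((suc k) + (suc k))))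
       × ((k : ℕ) → bSeq u t k ≈ matchingSum u t k (pathEdges (k + k)))
mainTheorem10 R u t = aSeq≈cycleMatchingSum , bSeq≈pathMatchingSum
  where open MatchingSums.Weighted R u t
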